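{- Suppose we have a derivation in Extended Polynomial Calculus over $\mathbb{Z}$ with the square root rule of an unsatisfiable CNF from $M + x_1 + \ldots + 2^{n - 1}x_n=0$ and the Boolean axioms. Then at least one of the following three conditions holds: \begin{itemize} \item The number of clauses in this CNF is at least $2^{n/3}$. \item We have derived a polynomial equation $C' \cdot (y_j^2 - y_j) = 0$ and the constant $C'$ is divisible by at least $\Omega(2^{n/3})$ different prime numbers. \item There is a clause $C \cdot y_{j_1} \cdots y_{j_k} \cdot \neg{y}_{\ell_1} \cdots \neg{y}_{\ell_r}$ such that the constant $C$ is divisible by at least $\Omega(2^{n/3})$ different prime numbers. \end{itemize}
   Context: $M>0$ is an integer, and the Boolean axioms are $x_i^2-x_i=0$. Extended Polynomial Calculus over $\mathbb{Z}$ derives polynomials (read as equations $=0$) by integer linear combinations and multiplication by variables, allows extension axioms $y_j - q_j(\bar x, y_1,\ldots,y_{j-1})$ introducing new variables, and the square root rule derives $r$ from $r^2$. Deriving an unsatisfiable CNF over $\mathbb{Z}$ means deriving equations $C_i\cdot y_{j_1}\cdots y_{j_k}\cdot\neg y_{\ell_1}\cdots\neg y_{\ell_r}=0$, one per clause, with nonzero integer constants $C_i$, where the $y$'s may be extension variables and $\neg y_\ell$ is an extension variable defined by $\neg y_\ell = 1-y_\ell$, and also deriving $C'_j\cdot(y_j^2-y_j)=0$ with a nonzero integer $C'_j$ for every variable $y_j$ occurring in the CNF. -}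

module Defs where

open import Data.Nat using (ℕ; zero; suc; _<_; _≤_; _^_; _*_)
open import Data.Nat.Divisibility using (_∣_)
open import Data.Nat.Primality using (Prime)
open import Data.Integer as ℤ using (ℤ; +_; ∣_∣)
open import Data.Fin using (Fin; toℕ)
open import Data.List using (List; []; _∷_; foldr; length; allFin)
open import Data.List.Relation.Unary.All using (All)
open import Data.List.Relation.Unary.Any using (Any)
open import Data.List.Relation.Unary.Unique.Propositional using (Unique)
open import Data.Product using (Σ; _×_; _,_; proj₁; proj₂)
open import Data.Sum using (_⊎_; inj₁; inj₂)
open import Data.Unit using (⊤)
open import Data.Empty using (⊥)
open import Data.Bool using (Bool; true; false)
open import Relation.Binary.PropositionalEquality using (_≡_; _≢_)

infixl 6 _⊕_
infixl 7 _⊗_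

data Poly (V : Set) : Set where
  con : ℤ → Poly V
  var : V → Poly V
  _⊕_ : Poly V → Poly V → Poly V
  _⊗_ : Poly V → Poly V → Poly V

module _ {V : Set} where

  infixl 6 _⊖_

  eval : (V → ℤ) → Poly V → ℤ
  eval ρ (con c) = c
  eval ρ (var v) = ρ v
  eval ρ (p ⊕ q) = eval ρ p ℤ.+ eval ρ q
  eval ρ (p ⊗ q) = eval ρ p ℤ.* eval ρ q

  -- equality of polynomials in ℤ[V] (ℤ is an infinite integral domain,
  -- so this is exactly identity of polynomials)
  _≈P_ : Poly V → Poly V → Set
  p ≈P q = (ρ : V → ℤ) → eval ρ p ≡ eval ρ q

  _⊖_ : Poly V → Poly V → Poly V
  p ⊖ q = p ⊕ con (ℤ.- (+ 1)) ⊗ q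

  boolPoly : V → Poly V
  boolPoly v = var v ⊗ var v ⊖ var v

-- Polynomial calculus over ℤ with the square root rule,
-- from a set of axioms Ax (lines are polynomials, read as "= 0")

data Derives {V : Set} (Ax : Poly V → Set) : Poly V → Set where
  axiom  : ∀ {p} → Ax p → Derives Ax p
  lin    : ∀ {p q} (a b : ℤ) → Derives Ax p → Derives Ax q →
           Derives Ax (con a ⊗ p ⊕ con b ⊗ q)
  mulVar : ∀ {p} (v : V) → Derives Ax p → Derives Ax (var v ⊗ p)
  sqrt   : ∀ {r} → Derives Ax (r ⊗ r) → Derives Ax r
  -- lines are polynomials, so syntactically different but equal
  -- polynomials are the same line
  same   : ∀ {p q} → Derives Ax p → p ≈P q → Derives Ax q

-- Variables: original x_{i+1} (i : Fin n) and extension variables y_j (j : ℕ)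

Var : ℕ → Set
Var n = Fin n ⊎ ℕ

module _ {n : ℕ} where

  x : Fin n → Poly (Var n)
  x i = var (inj₁ i)

  y : ℕ → Poly (Var n)
  y j = var (inj₂ j)

  Below : ℕ → Poly (Var n) → Set
  Below j (con _) = ⊤
  Below j (var (inj₁ _)) = ⊤
  Below j (var (inj₂ k)) = k < j
  Below j (p ⊕ q) = Below j p × Below j q
  Below j (p ⊗ q) = Below j p × Below j q

mainPoly : (n M : ℕ) → Poly (Var n)
mainPoly n M = foldr (λ i acc → acc ⊕ con (+ (2 ^ toℕ i)) ⊗ x i) (con (+ M)) (allFin n)

data Axiom (n M m : ℕ) (q : Fin m → Poly (Var n)) : Poly (Var n) → Set where
  bool : (i : Fin n) → Axiom n M m q (boolPoly (inj₁ i))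
  main : Axiom n M m q (mainPoly n M)
  ext  : (j : Fin m) → Axiom n M m q (y (toℕ j) ⊖ q j)

-- a literal (v , true) is v, a literal (v , false) is ¬ v
Literal : ℕ → Set
Literal n = Var n × Bool

Clause : ℕ → Set
Clause n = List (Literal n)

-- the clause polynomial: product of the negations of its literals;
-- clause (¬y_j1 ∨ … ∨ ¬y_jk ∨ y_l1 ∨ … ∨ y_lr) ↦ y_j1⋯y_jk·(1-y_l1)⋯(1-y_lr)
litFactor : ∀ {n} → Literal n → Poly (Var n)
litFactor (v , true)  = con (+ 1) ⊖ var v
litFactor (v , false) = var v

clausePoly : ∀ {n} → Clause n → Poly (Var n)
clausePoly = foldr (λ l acc → litFactor l ⊗ acc) (con (+ 1))

Satisfies : ∀ {n} → (Var n → Bool) → Clause n → Set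
Satisfies α cl = Any (λ l → α (proj₁ l) ≡ proj₂ l) cl

-- a CNF where each clause comes with the constant C of its derived equation
CNF : ℕ → Set
CNF n = List (ℤ × Clause n)

Unsat : ∀ {n} → CNF n → Set
Unsat F = (α : Var _ → Bool) → All (λ e → Satisfies α (proj₂ e)) F → ⊥

Occurs : ∀ {n} → Var n → CNF n → Set
Occurs v F = Any (λ e → Any (λ l → proj₁ l ≡ v) (proj₂ e)) F

record Refutation (n M : ℕ) : Set where
  field
    m      : ℕ
    q      : Fin m → Poly (Var n)           -- y_j := q_j(x, y_0..y_{j-1})
    q-wf   : (j : Fin m) → Below (toℕ j) (q j)
    cnf    : CNF n
    unsat  : Unsat cnf
    clauseDerived : All (λ e → (proj₁ e ≢ ℤ.0ℤ) ×
                      Derives (Axiom n M m q) (con (proj₁ e) ⊗ clausePoly (proj₂ e))) cnf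
    boolConst   : Var n → ℤ
    boolDerived : (v : Var n) → Occurs v cnf →
                  (boolConst v ≢ ℤ.0ℤ) ×
                  Derives (Axiom n M m q) (con (boolConst v) ⊗ boolPoly v)

-- "C is divisible by at least k different primes" with k ≥ (1/d)·2^{n/3},
-- i.e. (d·k)^3 ≥ 2^n

ManyPrimes : (d n : ℕ) → ℤ → Set
ManyPrimes d n C = Σ (List ℕ) λ ps →
  Unique ps × All Prime ps × All (λ p → p ∣ ∣ C ∣) ps ×
  2 ^ n ≤ (d * length ps) ^ 3

{-# OPTIONS --safe #-}

-- Fix a prime p ≤ 2^n and pick s < p with p ∣ M + s. Setting x to the binary digits of s and
-- every extension variable to the value of its definition gives an integer point at which all
-- axioms vanish modulo p; by Euclid's lemma (needed for the square root rule) so does every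
-- derived line. Reading v as true iff v ≡ 1 (mod p), the unsatisfiable CNF has a falsified
-- clause C·∏(literal factors), and all its factors are units mod p, so p ∣ C.
-- Since C(2m, m) ≥ 2^m and every prime power dividing C(2m, m) is at most 2m, there are at
-- least 2^(n-1)/n primes up to 2^n. By pigeonhole one of the L clause constants is divisible by
-- at least 2^(n-1)/(nL) of them, which is at least 2^(n/3)/2 when L³ < 2^n and n ≥ 12.

module Submission where

open import Defs
open import Data.Nat using (ℕ; suc; _≤_; _^_; s≤s; z≤n)
open import Data.List using (length)
open import Data.List.Relation.Unary.Any using (Any)
open import Data.Product using (Σ; _×_; _,_; proj₁)
open import Data.Sum using (_⊎_; inj₂; map₂)

module PrimeCounting where

  open import Data.Nat
  open import Data.Nat.Properties
  open import Data.Nat.Divisibility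
  open import Data.Nat.Primality
  open import Data.Nat.Induction using (<-wellFounded)
  open import Induction.WellFounded using (Acc; acc)
  open import Data.Product using (∃; ∃-syntax; _×_; _,_)
  open import Data.List using (List; []; _∷_; length; filter; upTo)
  open import Data.List.Relation.Unary.All using (All; []; _∷_)
  import Data.List.Relation.Unary.All as All
  open import Data.List.Relation.Unary.All.Properties using (all-filter)
  open import Data.List.Relation.Unary.Any using (here; there)
  open import Data.List.Membership.Propositional using (_∈_)
  open import Data.List.Membership.Propositional.Properties using (∈-filter⁺; ∈-filter⁻; ∈-upTo⁺; ∈-upTo⁻)
  open import Data.Nat.Combinatorics using (k![n∸k]!∣n!)
  open import Data.Nat.ListAction using (product)
  open import Data.Nat.Primality.Factorisation using (factorise)
  open import Data.Sum using (inj₁; inj₂)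
  open import Relation.Nullary using (¬_; yes; no; contradiction)
  open import Relation.Binary.PropositionalEquality
  open import Data.Nat.Solver using (module +-*-Solver)
  open +-*-Solver

  module PrimeValuation {p : ℕ} (p-prime : Prime p) where

    private instance
      p≢0 : NonZero p
      p≢0 = prime⇒nonZero p-prime

    1<p : 1 < p
    1<p = nonTrivial⇒n>1 p {{prime⇒nonTrivial p-prime}}

    p∤1 : ¬ p ∣ 1
    p∤1 p∣1 = <⇒≢ 1<p (sym (∣1⇒≡1 p∣1))

    p∤*p∤⇒p∤* : ∀ {m n} → ¬ p ∣ m → ¬ p ∣ n → ¬ p ∣ m * n
    p∤*p∤⇒p∤* {m} {n} p∤m p∤n p∣mn with euclidsLemma m n p-prime p∣mn
    ... | inj₁ p∣m = p∤m p∣m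
    ... | inj₂ p∣n = p∤n p∣n

    record Valuation (n e : ℕ) : Set where
      constructor valuation
      field
        cofactor     : ℕ
        factored     : n ≡ p ^ e * cofactor
        p∤cofactor   : ¬ p ∣ cofactor

    p^a∣p^b*u⇒a≤b : ∀ a b {u} → ¬ p ∣ u → p ^ a ∣ p ^ b * u → a ≤ b
    p^a∣p^b*u⇒a≤b zero    b       p∤u _ = z≤n
    p^a∣p^b*u⇒a≤b (suc a) zero    {u} p∤u p^[1+a]∣u =
      contradiction (m*n∣⇒m∣ p (p ^ a) (subst (p ^ suc a ∣_) (*-identityˡ u) p^[1+a]∣u)) p∤u
    p^a∣p^b*u⇒a≤b (suc a) (suc b) {u} p∤u p^[1+a]∣ =
      s≤s (p^a∣p^b*u⇒a≤b a b p∤u (*-cancelˡ-∣ p (subst (p ^ suc a ∣_) (*-assoc p (p ^ b) u) p^[1+a]∣)))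

    valuation-1 : Valuation 1 0
    valuation-1 = valuation 1 refl p∤1

    valuation-∣ : ∀ {n e} → Valuation n e → p ^ e ∣ n
    valuation-∣ (valuation u refl _) = m∣m*n u

    valuation-maximal : ∀ {n e a} → Valuation n e → p ^ a ∣ n → a ≤ e
    valuation-maximal (valuation u refl p∤u) = p^a∣p^b*u⇒a≤b _ _ p∤u

    valuation-unique : ∀ {n a b} → Valuation n a → Valuation n b → a ≡ b
    valuation-unique {a = a} {b} va vb =
      ≤-antisym (valuation-maximal vb (valuation-∣ {e = a} va)) (valuation-maximal va (valuation-∣ {e = b} vb))

    valuation-exists : ∀ n .{{_ : NonZero n}} → ∃ (Valuation n)
    valuation-exists n = go n (<-wellFounded n)
      where
        go : ∀ n .{{_ : NonZero n}} → Acc _<_ n → ∃ (Valuation n)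
        go n (acc rec) with p ∣? n
        ... | no p∤n = 0 , valuation n (sym (*-identityˡ n)) p∤n
        ... | yes (divides (suc k) refl) with go (suc k) (rec (m<m*n (suc k) p 1<p))
        ...   | a , valuation u k≡p^a*u p∤u = suc a , valuation u n≡p^[1+a]*u p∤u
          where
            n≡p^[1+a]*u : suc k * p ≡ p * p ^ a * u
            n≡p^[1+a]*u = begin
              suc k * p       ≡⟨ cong (_* p) k≡p^a*u ⟩
              p ^ a * u * p   ≡⟨ solve 3 (λ A U P → A :* U :* P := P :* A :* U) refl (p ^ a) u p ⟩
              p * p ^ a * u   ∎
              where open ≡-Reasoning

    ¬∣-between : ∀ {q n} → q * p < n → n < suc q * p → ¬ p ∣ n
    ¬∣-between {q} q*p<n n<[1+q]*p (divides k refl) =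
      <⇒≱ (*-cancelʳ-< p q k q*p<n) (≤-pred (*-cancelʳ-< p k (suc q) n<[1+q]*p))

    -- q = ⌊n/p⌋: the multiples p, 2p, …, qp of p contribute the factor p^q q!
    factorial-split : ∀ n → ∃[ q ] ∃[ r ] n ! ≡ p ^ q * (q ! * r) × ¬ p ∣ r × q * p ≤ n × n < suc q * p
    factorial-split zero = 0 , 1 , refl , p∤1 , z≤n , subst (0 <_) (sym (+-identityʳ p)) (<-trans z<s 1<p)
    factorial-split (suc n) with factorial-split n
    ... | q , r , n!≡ , p∤r , q*p≤n , n<[1+q]*p with suc n ≟ suc q * p
    ...   | yes 1+n≡[1+q]*p = suc q , r , split , p∤r , ≤-reflexive (sym 1+n≡[1+q]*p) , 1+n<[2+q]*p
      where
        split : suc n ! ≡ p ^ suc q * (suc q ! * r)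
        split = begin
          suc n * n !                      ≡⟨ cong₂ _*_ 1+n≡[1+q]*p n!≡ ⟩
          suc q * p * (p ^ q * (q ! * r))  ≡⟨ solve 5 (λ Q P A F R → Q :* P :* (A :* (F :* R)) := P :* A :* (Q :* F :* R)) refl (suc q) p (p ^ q) (q !) r ⟩
          p * p ^ q * (suc q * q ! * r)    ∎
          where open ≡-Reasoning
        1+n<[2+q]*p : suc n < suc (suc q) * p
        1+n<[2+q]*p = subst (_< suc (suc q) * p) (sym 1+n≡[1+q]*p) (m<n+m (suc q * p) (<-trans z<s 1<p))
    ...   | no 1+n≢[1+q]*p = q , suc n * r , split , p∤*p∤⇒p∤* p∤1+n p∤r , m≤n⇒m≤1+n q*p≤n , 1+n<[1+q]*p
      where
        1+n<[1+q]*p : suc n < suc q * p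
        1+n<[1+q]*p = ≤∧≢⇒< n<[1+q]*p 1+n≢[1+q]*p
        p∤1+n : ¬ p ∣ suc n
        p∤1+n = ¬∣-between {q} (s≤s q*p≤n) 1+n<[1+q]*p
        split : suc n ! ≡ p ^ q * (q ! * (suc n * r))
        split = begin
          suc n * n !                  ≡⟨ cong (suc n *_) n!≡ ⟩
          suc n * (p ^ q * (q ! * r))  ≡⟨ solve 4 (λ N A F R → N :* (A :* (F :* R)) := A :* (F :* (N :* R))) refl (suc n) (p ^ q) (q !) r ⟩
          p ^ q * (q ! * (suc n * r))  ∎
          where open ≡-Reasoning

    valuation-factorial : ∀ {n q r e} → n ! ≡ p ^ q * (q ! * r) → ¬ p ∣ r → Valuation (q !) e → Valuation (n !) (q + e)
    valuation-factorial {n} {q} {r} {e} n!≡ p∤r (valuation u q!≡ p∤u) =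
      valuation (u * r) split (p∤*p∤⇒p∤* p∤u p∤r)
      where
        split : n ! ≡ p ^ (q + e) * (u * r)
        split = begin
          n !                          ≡⟨ n!≡ ⟩
          p ^ q * (q ! * r)            ≡⟨ cong (λ f → p ^ q * (f * r)) q!≡ ⟩
          p ^ q * (p ^ e * u * r)      ≡⟨ solve 4 (λ A E U R → A :* (E :* U :* R) := A :* E :* (U :* R)) refl (p ^ q) (p ^ e) u r ⟩
          p ^ q * p ^ e * (u * r)      ≡⟨ cong (_* (u * r)) (sym (^-distribˡ-+-* p q e)) ⟩
          p ^ (q + e) * (u * r)        ∎
          where open ≡-Reasoning

    quotient-<-pow : ∀ {q x} t → q * p ≤ x → x < p ^ suc t → q < p ^ t
    quotient-<-pow {q} {x} t q*p≤x x<p^[1+t] =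
      *-cancelʳ-< p q (p ^ t) (≤-<-trans q*p≤x (subst (x <_) (*-comm p (p ^ t)) x<p^[1+t]))

    quotient-≤-double : ∀ {qx qy x y} → qx * p ≤ x → x ≤ 2 * y + 1 → y < suc qy * p → qx ≤ 2 * qy + 1
    quotient-≤-double {qx} {qy} {x} {y} qx*p≤x x≤2y+1 y<[1+qy]*p =
      ≤-pred (*-cancelʳ-< p qx (suc (2 * qy + 1)) (begin-strict
        qx * p                ≤⟨ qx*p≤x ⟩
        x                     ≤⟨ x≤2y+1 ⟩
        2 * y + 1             <⟨ ≤-reflexive (solve 1 (λ Y → con 1 :+ (con 2 :* Y :+ con 1) := con 2 :* (con 1 :+ Y)) refl y) ⟩
        2 * suc y             ≤⟨ *-monoʳ-≤ 2 y<[1+qy]*p ⟩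
        2 * (suc qy * p)      ≡⟨ solve 2 (λ Q P → con 2 :* ((con 1 :+ Q) :* P) := (con 1 :+ (con 2 :* Q :+ con 1)) :* P) refl qy p ⟩
        suc (2 * qy + 1) * p  ∎))
      where open ≤-Reasoning

    -- Legendre: ν(x!) = ⌊x/p⌋ + ν(⌊x/p⌋!), and ⌊x/p⌋ ≤ 2⌊y/p⌋ + 1 whenever x ≤ 2y + 1
    valuation-factorial-≤ : ∀ t x y {a b} → x < p ^ suc t → x ≤ 2 * y + 1 →
                            Valuation (x !) a → Valuation (y !) b → a ≤ 2 * b + t
    valuation-quotients-≤ : ∀ t qx qy {a b} → qx < p ^ t → qx ≤ 2 * qy + 1 →
                            Valuation (qx !) a → Valuation (qy !) b → qx + a ≤ 2 * (qy + b) + t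

    valuation-factorial-≤ t x y x<p^[1+t] x≤2y+1 va vb
      with qx , rx , x!≡ , p∤rx , qx*p≤x , _ ← factorial-split x
         | qy , ry , y!≡ , p∤ry , _ , y<[1+qy]*p ← factorial-split y
      with a′ , va′ ← valuation-exists (qx !) {{qx !≢0}}
         | b′ , vb′ ← valuation-exists (qy !) {{qy !≢0}}
      rewrite valuation-unique va (valuation-factorial {x} {qx} x!≡ p∤rx va′)
            | valuation-unique vb (valuation-factorial {y} {qy} y!≡ p∤ry vb′)
      = valuation-quotients-≤ t qx qy (quotient-<-pow t qx*p≤x x<p^[1+t]) (quotient-≤-double {qy = qy} qx*p≤x x≤2y+1 y<[1+qy]*p) va′ vb′

    valuation-quotients-≤ zero _ _ {a} (s≤s z≤n) _ va _ with refl ← valuation-unique {a = a} va valuation-1 = z≤n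
    valuation-quotients-≤ (suc t) qx qy {a} {b} qx<p^[1+t] qx≤2qy+1 va vb = begin
      qx + a                       ≤⟨ +-mono-≤ qx≤2qy+1 (valuation-factorial-≤ t qx qy qx<p^[1+t] qx≤2qy+1 va vb) ⟩
      2 * qy + 1 + (2 * b + t)     ≡⟨ solve 3 (λ Q B T → con 2 :* Q :+ con 1 :+ (con 2 :* B :+ T) := con 2 :* (Q :+ B) :+ (con 1 :+ T)) refl qy b t ⟩
      2 * (qy + b) + suc t         ∎
      where open ≤-Reasoning

    prime-power-∣-central-binomial : ∀ m k {c} .{{_ : NonZero m}} → (m + m) ! ≡ c * (m ! * m !) → p ^ k ∣ c → p ^ k ≤ m + m
    prime-power-∣-central-binomial m zero _ _ = ≤-trans (>-nonZero⁻¹ m) (m≤m+n m m)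
    prime-power-∣-central-binomial m (suc t) [2m]!≡ p^k∣c with p ^ suc t ≤? m + m
    ... | yes p^k≤2m = p^k≤2m
    ... | no p^k≰2m
      with e , v[2m]! ← valuation-exists ((m + m) !) {{(m + m) !≢0}}
         | d , vm! ← valuation-exists (m !) {{m !≢0}}
      = contradiction (≤-trans lower upper) (<⇒≱ (≤-reflexive rearranged))
      where
        p^[k+2d]∣[2m]! : p ^ (suc t + (d + d)) ∣ (m + m) !
        p^[k+2d]∣[2m]! = subst₂ _∣_
          (sym (trans (^-distribˡ-+-* p (suc t) (d + d)) (cong (p ^ suc t *_) (^-distribˡ-+-* p d d))))
          (sym [2m]!≡)
          (*-pres-∣ p^k∣c (*-pres-∣ (valuation-∣ vm!) (valuation-∣ vm!)))
        lower : suc t + (d + d) ≤ e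
        lower = valuation-maximal v[2m]! p^[k+2d]∣[2m]!
        rearranged : suc (2 * d + t) ≡ suc t + (d + d)
        rearranged = solve 2 (λ D T → con 1 :+ (con 2 :* D :+ T) := con 1 :+ T :+ (D :+ D)) refl d t
        upper : e ≤ 2 * d + t
        upper = valuation-factorial-≤ t (m + m) m (≰⇒> p^k≰2m)
                  (≤-trans (≤-reflexive (cong (m +_) (sym (+-identityʳ m)))) (m≤m+n _ 1)) v[2m]! vm!

  open PrimeValuation using (valuation; valuation-exists; prime-power-∣-central-binomial)

  central-binomial-≥ : ∀ m → 2 ^ m * (m ! * m !) ≤ (m + m) !
  central-binomial-≥ zero = ≤-refl
  central-binomial-≥ (suc m) rewrite +-suc m m = begin
    2 * 2 ^ m * (suc m * m ! * (suc m * m !))          ≡⟨ regroup ⟩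
    2 * suc m * suc m * (2 ^ m * (m ! * m !))          ≤⟨ *-mono-≤ new-factors (central-binomial-≥ m) ⟩
    suc (suc (m + m)) * suc (m + m) * (m + m) !        ≡⟨ *-assoc (suc (suc (m + m))) (suc (m + m)) ((m + m) !) ⟩
    suc (suc (m + m)) * (suc (m + m) * (m + m) !)      ∎
    where
      open ≤-Reasoning
      regroup : 2 * 2 ^ m * (suc m * m ! * (suc m * m !)) ≡ 2 * suc m * suc m * (2 ^ m * (m ! * m !))
      regroup = solve 3 (λ M A F → con 2 :* A :* ((con 1 :+ M) :* F :* ((con 1 :+ M) :* F))
                                 := con 2 :* (con 1 :+ M) :* (con 1 :+ M) :* (A :* (F :* F))) refl m (2 ^ m) (m !)
      new-factors : 2 * suc m * suc m ≤ suc (suc (m + m)) * suc (m + m)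
      new-factors = begin
        2 * suc m * suc m                  ≡⟨ solve 1 (λ M → con 2 :* (con 1 :+ M) :* (con 1 :+ M) := (con 2 :+ (M :+ M)) :* (con 1 :+ M)) refl m ⟩
        suc (suc (m + m)) * suc m          ≤⟨ *-monoʳ-≤ (suc (suc (m + m))) (s≤s (m≤n+m m m)) ⟩
        suc (suc (m + m)) * suc (m + m)    ∎

  ≤-prime-powers^length : ∀ ps {n B} .{{_ : NonZero n}} → All Prime ps →
    (∀ {q} → Prime q → q ∣ n → q ∈ ps) → (∀ {q} k → Prime q → q ^ k ∣ n → q ^ k ≤ B) →
    n ≤ B ^ length ps
  ≤-prime-powers^length [] {n} _ ∈ps _ with factorise n
  ... | record { factors = [] ; isFactorisation = n≡1 } = ≤-reflexive n≡1
  ... | record { factors = q ∷ qs ; isFactorisation = n≡q*∏qs ; factorsPrime = q-prime ∷ _ }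
    with () ← ∈ps q-prime (divides (product qs) (trans n≡q*∏qs (*-comm q _)))
  ≤-prime-powers^length (q ∷ ps) {n} {B} (q-prime ∷ ps-prime) ∈q∷ps q^k≤B
    with a , valuation u n≡q^a*u q∤u ← valuation-exists q-prime n
    = begin
      n                     ≡⟨ n≡q^a*u ⟩
      q ^ a * u             ≤⟨ *-mono-≤ (q^k≤B a q-prime (divides u (trans n≡q^a*u (*-comm (q ^ a) u)))) u≤B^|ps| ⟩
      B * B ^ length ps     ∎
    where
      open ≤-Reasoning
      u∣n : u ∣ n
      u∣n = divides (q ^ a) n≡q^a*u
      instance
        u≢0 : NonZero u
        u≢0 = ≢-nonZero (λ u≡0 → q∤u (subst (q ∣_) (sym u≡0) (q ∣0)))
      ∈ps : ∀ {r} → Prime r → r ∣ u → r ∈ ps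
      ∈ps r-prime r∣u with ∈q∷ps r-prime (∣-trans r∣u u∣n)
      ... | here refl = contradiction r∣u q∤u
      ... | there r∈ps = r∈ps
      u≤B^|ps| : u ≤ B ^ length ps
      u≤B^|ps| = ≤-prime-powers^length ps ps-prime ∈ps (λ k r-prime r^k∣u → q^k≤B k r-prime (∣-trans r^k∣u u∣n))

  primesUpTo : ℕ → List ℕ
  primesUpTo N = filter prime? (upTo (suc N))

  ∈-primesUpTo⁺ : ∀ {N q} → Prime q → q ≤ N → q ∈ primesUpTo N
  ∈-primesUpTo⁺ q-prime q≤N = ∈-filter⁺ prime? (∈-upTo⁺ (s≤s q≤N)) q-prime

  primesUpTo-bounded : ∀ N → All (λ q → Prime q × q ≤ N) (primesUpTo N)
  primesUpTo-bounded N = All.tabulate λ q∈ → let q∈upTo , q-prime = ∈-filter⁻ prime? {xs = upTo (suc N)} q∈ in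
    q-prime , ≤-pred (∈-upTo⁻ q∈upTo)

  2^m≤[2m]^π[2m] : ∀ m .{{_ : NonZero m}} → 2 ^ m ≤ (m + m) ^ length (primesUpTo (m + m))
  2^m≤[2m]^π[2m] m with divides c [2m]!≡ ← k![n∸k]!∣n! {m + m} {m} (m≤m+n m m) = ≤-trans 2^m≤c c≤[2m]^π
    where
      instance
        m!m!≢0 : NonZero (m ! * m !)
        m!m!≢0 = m !* m !≢0
      [2m]!≡c*m!m! : (m + m) ! ≡ c * (m ! * m !)
      [2m]!≡c*m!m! = trans [2m]!≡ (cong (λ k → c * (m ! * k !)) (m+n∸m≡n m m))
      2^m≤c : 2 ^ m ≤ c
      2^m≤c = *-cancelʳ-≤ (2 ^ m) c (m ! * m !) (≤-trans (central-binomial-≥ m) (≤-reflexive [2m]!≡c*m!m!))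
      instance
        c≢0 : NonZero c
        c≢0 = >-nonZero (≤-trans (m^n>0 2 m) 2^m≤c)
      prime-power-bound : ∀ {q} k → Prime q → q ^ k ∣ c → q ^ k ≤ m + m
      prime-power-bound k q-prime = prime-power-∣-central-binomial q-prime m k [2m]!≡c*m!m!
      c≤[2m]^π : c ≤ (m + m) ^ length (primesUpTo (m + m))
      c≤[2m]^π = ≤-prime-powers^length (primesUpTo (m + m)) (all-filter prime? (upTo (suc (m + m))))
        (λ q-prime q∣c → ∈-primesUpTo⁺ q-prime (subst (_≤ m + m) (*-identityʳ _)
           (prime-power-bound 1 q-prime (subst (_∣ c) (sym (*-identityʳ _)) q∣c))))
        prime-power-bound

  primeCount-lower : ∀ n → 2 ^ n ≤ suc n * length (primesUpTo (2 ^ suc n))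
  primeCount-lower n = ≮⇒≥ λ [1+n]π<2^n → <⇒≱ (^-monoʳ-< 2 (s≤s (s≤s z≤n)) [1+n]π<2^n) 2^[2^n]≤2^[[1+n]π]
    where
      instance
        2^n≢0 : NonZero (2 ^ n)
        2^n≢0 = m^n≢0 2 n
      2^n+2^n≡2^[1+n] : 2 ^ n + 2 ^ n ≡ 2 ^ suc n
      2^n+2^n≡2^[1+n] = cong (2 ^ n +_) (sym (+-identityʳ (2 ^ n)))
      2^[2^n]≤2^[[1+n]π] : 2 ^ (2 ^ n) ≤ 2 ^ (suc n * length (primesUpTo (2 ^ suc n)))
      2^[2^n]≤2^[[1+n]π] = begin
        2 ^ (2 ^ n)                                             ≤⟨ 2^m≤[2m]^π[2m] (2 ^ n) ⟩
        (2 ^ n + 2 ^ n) ^ length (primesUpTo (2 ^ n + 2 ^ n))   ≡⟨ cong (λ N → N ^ length (primesUpTo N)) 2^n+2^n≡2^[1+n] ⟩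
        (2 ^ suc n) ^ length (primesUpTo (2 ^ suc n))           ≡⟨ ^-*-assoc 2 (suc n) (length (primesUpTo (2 ^ suc n))) ⟩
        2 ^ (suc n * length (primesUpTo (2 ^ suc n)))           ∎
        where open ≤-Reasoning

module Pigeonhole where

  open import Data.Nat
  open import Data.Nat.Properties
  open import Data.List using (List; []; _∷_; length; filter)
  open import Data.List.Relation.Unary.All as All using (All; []; _∷_)
  import Data.List.Relation.Unary.All.Properties as Allₚ
  open import Data.List.Relation.Unary.Any using (Any; here; there; satisfied)
  import Data.List.Relation.Unary.Any as Any
  open import Data.List.Relation.Unary.Any.Properties using (Any-⊎⁻)
  open import Data.List.Relation.Binary.Sublist.Propositional.Properties using (filter⁺; filter-⊆; length-mono-≤)
  open import Data.Product using (_,_; proj₂)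
  open import Data.Sum using (_⊎_; inj₁; inj₂; [_,_]′)
  open import Function using (id; _∘_)
  open import Relation.Nullary using (Dec; yes; no; ¬?; contradiction)
  open import Relation.Unary using (Pred; Decidable)
  open import Relation.Binary.PropositionalEquality

  module _ {a p} {A : Set a} {P : Pred A p} (P? : Decidable P) where

    length-filter-∁ : ∀ xs → length (filter P? xs) + length (filter (¬? ∘ P?) xs) ≡ length xs
    length-filter-∁ [] = refl
    length-filter-∁ (x ∷ xs) with P? x
    ... | yes _ = cong suc (length-filter-∁ xs)
    ... | no  _ = trans (+-suc _ _) (cong suc (length-filter-∁ xs))

    length-filter-filter : ∀ {q} {Q : Pred A q} (Q? : Decidable Q) xs →
                           length (filter P? (filter Q? xs)) ≤ length (filter P? xs)
    length-filter-filter Q? xs = length-mono-≤ (filter⁺ P? P? (λ { refl → id }) (filter-⊆ Q? xs))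

  module _ {A B : Set} {R : A → B → Set} (R? : ∀ a b → Dec (R a b)) where

    count : B → List A → ℕ
    count b xs = length (filter (λ a → R? a b) xs)

    pigeonhole : ∀ bs xs → All (λ a → Any (R a) bs) xs →
                 xs ≡ [] ⊎ Any (λ b → length xs ≤ length bs * count b xs) bs
    pigeonhole []       []       _        = inj₁ refl
    pigeonhole []       (_ ∷ _)  (() ∷ _)
    pigeonhole (b ∷ bs) xs       xs-hit = inj₂ (extend (pigeonhole bs missed missed-hit))
      where
        open ≤-Reasoning
        c : ℕ
        c = count b xs
        missed : List A
        missed = filter (λ a → ¬? (R? a b)) xs
        count-missed-≤ : ∀ b′ → count b′ missed ≤ count b′ xs
        count-missed-≤ b′ = length-filter-filter (λ a → R? a b′) (λ a → ¬? (R? a b)) xs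
        missed-hit : All (λ a → Any (R a) bs) missed
        missed-hit = All.zipWith (λ { (here Rab , ¬Rab) → contradiction Rab ¬Rab ; (there hit , _) → hit })
          (Allₚ.filter⁺ (λ a → ¬? (R? a b)) xs-hit , Allₚ.all-filter (λ a → ¬? (R? a b)) xs)
        |xs|≡c+|missed| : length xs ≡ c + length missed
        |xs|≡c+|missed| = sym (length-filter-∁ (λ a → R? a b) xs)
        better-of : ∀ {b′} → length missed ≤ length bs * count b′ missed →
                  length xs ≤ length (b ∷ bs) * c ⊎ length xs ≤ length (b ∷ bs) * count b′ xs
        better-of {b′} |missed|≤ with count b′ xs ≤? c
        ... | yes c′≤c = inj₁ (begin
          length xs                          ≡⟨ |xs|≡c+|missed| ⟩
          c + length missed                  ≤⟨ +-monoʳ-≤ c (≤-trans |missed|≤ (*-monoʳ-≤ (length bs) (≤-trans (count-missed-≤ b′) c′≤c))) ⟩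
          c + length bs * c                  ∎)
        ... | no c′≰c = inj₂ (begin
          length xs                          ≡⟨ |xs|≡c+|missed| ⟩
          c + length missed                  ≤⟨ +-mono-≤ (<⇒≤ (≰⇒> c′≰c)) (≤-trans |missed|≤ (*-monoʳ-≤ (length bs) (count-missed-≤ b′))) ⟩
          count b′ xs + length bs * count b′ xs ∎)
        extend : missed ≡ [] ⊎ Any (λ b′ → length missed ≤ length bs * count b′ missed) bs →
                 Any (λ b′ → length xs ≤ length (b ∷ bs) * count b′ xs) (b ∷ bs)
        extend (inj₁ missed≡[]) = here (begin
          length xs                 ≡⟨ |xs|≡c+|missed| ⟩
          c + length missed         ≡⟨ cong (λ ys → c + length ys) missed≡[] ⟩
          c + 0                     ≤⟨ +-monoʳ-≤ c z≤n ⟩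
          c + length bs * c         ∎)
        extend (inj₂ some) = [ here ∘ proj₂ ∘ satisfied , there ]′ (Any-⊎⁻ (Any.map better-of some))

module ModularSemantics where

  open import Data.Nat as ℕ using (ℕ; zero; suc; NonZero; s≤s)
  import Data.Nat.Properties as ℕ
  import Data.Nat.Divisibility as ℕ
  open import Data.Nat.DivMod using (_%_; _/_; m≡m%n+[m/n]*n; m%n<n; m<n*o⇒m/o<n)
  open import Data.Nat.Primality using (Prime; euclidsLemma; prime⇒nonTrivial; prime⇒nonZero)
  open import Data.Integer as ℤ using (ℤ; +_; 0ℤ; 1ℤ; -1ℤ; _+_; _*_)
  open import Data.Integer.Properties using (+-*-semiring; pos-+; pos-*; abs-*; *-assoc; -1*i≡-i; +-inverseʳ; +-identityʳ; *-identityˡ)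
  open import Data.Integer.Divisibility.Signed using (_∣_; _∣?_; divides; ∣ᵤ⇒∣; ∣⇒∣ᵤ; ∣m∣n⇒∣m+n; ∣n⇒∣m*n)
  import Data.Integer.Solver as ℤ-Solver
  import Data.Nat.Solver as ℕ-Solver
  open import Algebra.Properties.Semiring.Sum +-*-semiring using (sum-syntax; sum-cong-≗; *-distribˡ-sum)
  open import Data.Fin as Fin using (Fin; toℕ; fromℕ<)
  open import Data.Fin.Properties using (fromℕ<-toℕ; toℕ<n)
  open import Data.Bool using (Bool; true; false)
  open import Data.List using ([]; _∷_; foldr; tabulate)
  open import Data.List.Relation.Unary.All as All using (All)
  open import Data.List.Relation.Unary.All.Properties using (¬Any⇒All¬)
  open import Data.List.Relation.Unary.Any using (Any; here; there; any?)
  open import Data.Product using (∃-syntax; Σ-syntax; _×_; _,_; proj₁; proj₂)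
  open import Data.Sum using (_⊎_; inj₁; inj₂)
  open import Data.Empty using (⊥-elim)
  open import Function using (_∘_; id)
  open import Relation.Nullary using (¬_; yes; no; does; contradiction)
  open import Relation.Nullary.Decidable using (dec-true; dec-false)
  open import Relation.Binary.PropositionalEquality

  euclidsLemmaℤ : ∀ {p} → Prime p → ∀ i j → + p ∣ i * j → + p ∣ i ⊎ + p ∣ j
  euclidsLemmaℤ p-prime i j p∣ij with euclidsLemma ℤ.∣ i ∣ ℤ.∣ j ∣ p-prime (subst (_ ℕ.∣_) (abs-* i j) (∣⇒∣ᵤ p∣ij))
  ... | inj₁ p∣i = inj₁ (∣ᵤ⇒∣ p∣i)
  ... | inj₂ p∣j = inj₂ (∣ᵤ⇒∣ p∣j)

  prime∤1ℤ : ∀ {p} → Prime p → ¬ + p ∣ 1ℤ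
  prime∤1ℤ {p} p-prime p∣1 = ℕ.<⇒≢ (ℕ.nonTrivial⇒n>1 p {{prime⇒nonTrivial p-prime}}) (sym (ℕ.∣1⇒≡1 (∣⇒∣ᵤ p∣1)))

  module _ {V : Set} {Ax : Poly V → Set} (ρ : V → ℤ) {p : ℕ} (p-prime : Prime p)
           (axioms-vanish : ∀ {a} → Ax a → + p ∣ eval ρ a) where

    derivable-vanish : ∀ {r} → Derives Ax r → + p ∣ eval ρ r
    derivable-vanish (axiom ax)       = axioms-vanish ax
    derivable-vanish (lin a b d₁ d₂)  = ∣m∣n⇒∣m+n (∣n⇒∣m*n a (derivable-vanish d₁)) (∣n⇒∣m*n b (derivable-vanish d₂))
    derivable-vanish (mulVar v d)     = ∣n⇒∣m*n (ρ v) (derivable-vanish d)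
    derivable-vanish (sqrt {r} d) with euclidsLemmaℤ p-prime (eval ρ r) (eval ρ r) (derivable-vanish d)
    ... | inj₁ p∣r = p∣r
    ... | inj₂ p∣r = p∣r
    derivable-vanish (same d p≈q)     = subst (+ p ∣_) (p≈q ρ) (derivable-vanish d)

  [1-v]+v≡1 : ∀ v → 1ℤ + -1ℤ * v + v ≡ 1ℤ
  [1-v]+v≡1 = solve 1 (λ v → con 1ℤ :+ con -1ℤ :* v :+ v := con 1ℤ) refl
    where open ℤ-Solver.+-*-Solver

  module _ {n : ℕ} (ρ : Var n → ℤ) {p : ℕ} (p-prime : Prime p) where

    -- v is true iff ρ v ≡ 1 (mod p); litFactor (v , true) is 1 - v
    truthModP : Var n → Bool
    truthModP v = does (+ p ∣? eval ρ (litFactor (v , true)))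

    clause-vanishes⇒satisfied : ∀ cl → + p ∣ eval ρ (clausePoly cl) → Satisfies truthModP cl
    clause-vanishes⇒satisfied [] p∣1 = contradiction p∣1 (prime∤1ℤ p-prime)
    clause-vanishes⇒satisfied (l@(v , true) ∷ cl) p∣ with euclidsLemmaℤ p-prime (eval ρ (litFactor l)) _ p∣
    ... | inj₁ p∣1-v = here (dec-true (_ ∣? _) p∣1-v)
    ... | inj₂ p∣rest = there (clause-vanishes⇒satisfied cl p∣rest)
    clause-vanishes⇒satisfied (l@(v , false) ∷ cl) p∣ with euclidsLemmaℤ p-prime (ρ v) _ p∣
    ... | inj₁ p∣v = here (dec-false (_ ∣? _) p∤1-v)
      where
        p∤1-v : ¬ + p ∣ eval ρ (litFactor (v , true))
        p∤1-v p∣1-v = prime∤1ℤ p-prime (subst (+ p ∣_) ([1-v]+v≡1 (ρ v)) (∣m∣n⇒∣m+n p∣1-v p∣v))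
    ... | inj₂ p∣rest = there (clause-vanishes⇒satisfied cl p∣rest)

  eval-cong-Below : ∀ {n} j (r : Poly (Var n)) {σ τ : Var n → ℤ} → Below j r →
    (∀ i → σ (inj₁ i) ≡ τ (inj₁ i)) → (∀ k → k ℕ.< j → σ (inj₂ k) ≡ τ (inj₂ k)) → eval σ r ≡ eval τ r
  eval-cong-Below j (con c)        _         _       _       = refl
  eval-cong-Below j (var (inj₁ i)) _         x-agree _       = x-agree i
  eval-cong-Below j (var (inj₂ k)) k<j       _       y-agree = y-agree k k<j
  eval-cong-Below j (r ⊕ s)        (br , bs) x-agree y-agree =
    cong₂ _+_ (eval-cong-Below j r br x-agree y-agree) (eval-cong-Below j s bs x-agree y-agree)
  eval-cong-Below j (r ⊗ s)        (br , bs) x-agree y-agree =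
    cong₂ _*_ (eval-cong-Below j r br x-agree y-agree) (eval-cong-Below j s bs x-agree y-agree)

  a-a≡0 : ∀ a → a + -1ℤ * a ≡ 0ℤ
  a-a≡0 a = trans (cong (_+_ a) (-1*i≡-i a)) (+-inverseʳ a)

  module Extension {n m : ℕ} (q : Fin m → Poly (Var n)) (ξ : Fin n → ℤ) where

    withExtension : (ℕ → ℤ) → Var n → ℤ
    withExtension η (inj₁ i) = ξ i
    withExtension η (inj₂ k) = η k

    -- junk value 0 for the undefined variables y_j, j ≥ m
    definition : ℕ → (ℕ → ℤ) → ℤ
    definition j η with j ℕ.<? m
    ... | yes j<m = eval (withExtension η) (q (fromℕ< j<m))
    ... | no _    = 0ℤ

    -- stage j k is the value of y_k once y_0, …, y_{j-1} have been defined (0 for k ≥ j)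
    stage : ℕ → ℕ → ℤ
    stage zero    k = 0ℤ
    stage (suc j) k with k ℕ.≟ j
    ... | yes _ = definition j (stage j)
    ... | no  _ = stage j k

    extend : Var n → ℤ
    extend = withExtension (λ k → stage (suc k) k)

    stage-diagonal : ∀ k → stage (suc k) k ≡ definition k (stage k)
    stage-diagonal k with k ℕ.≟ k
    ... | yes _   = refl
    ... | no k≢k = contradiction refl k≢k

    stage-stable : ∀ j k → k ℕ.< j → stage j k ≡ stage (suc k) k
    stage-stable (suc j) k k<1+j with k ℕ.≟ j
    ... | yes refl = sym (stage-diagonal k)
    ... | no k≢j   = stage-stable j k (ℕ.≤∧≢⇒< (ℕ.≤-pred k<1+j) k≢j)

    definition-toℕ : ∀ j → definition (toℕ j) (stage (toℕ j)) ≡ eval (withExtension (stage (toℕ j))) (q j)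
    definition-toℕ j with toℕ j ℕ.<? m
    ... | yes j<m = cong (eval (withExtension (stage (toℕ j))) ∘ q) (fromℕ<-toℕ j j<m)
    ... | no j≮m  = contradiction (toℕ<n j) j≮m

    extend-defines : (∀ j → Below (toℕ j) (q j)) → ∀ j → extend (inj₂ (toℕ j)) ≡ eval extend (q j)
    extend-defines q-wf j = begin
      stage (suc (toℕ j)) (toℕ j)                  ≡⟨ stage-diagonal (toℕ j) ⟩
      definition (toℕ j) (stage (toℕ j))           ≡⟨ definition-toℕ j ⟩
      eval (withExtension (stage (toℕ j))) (q j)   ≡⟨ eval-cong-Below (toℕ j) (q j) (q-wf j) (λ _ → refl) (stage-stable (toℕ j)) ⟩
      eval extend (q j)                            ∎
      where open ≡-Reasoning

    extension-axioms-vanish : (∀ j → Below (toℕ j) (q j)) → ∀ j → eval extend (y (toℕ j) ⊖ q j) ≡ 0ℤ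
    extension-axioms-vanish q-wf j =
      trans (cong (λ a → a + -1ℤ * eval extend (q j)) (extend-defines q-wf j)) (a-a≡0 (eval extend (q j)))

  eval-foldr-tabulate : ∀ {n k} M (f : Fin k → Fin n) (ρ : Var n → ℤ) →
    eval ρ (foldr (λ i acc → acc ⊕ con (+ (2 ℕ.^ toℕ i)) ⊗ x i) (con (+ M)) (tabulate f))
      ≡ + M + ∑[ i < k ] (+ (2 ℕ.^ toℕ (f i)) * ρ (inj₁ (f i)))
  eval-foldr-tabulate {k = zero}  M f ρ = sym (+-identityʳ (+ M))
  eval-foldr-tabulate {k = suc k} M f ρ =
    trans (cong (_+ (+ (2 ℕ.^ toℕ (f Fin.zero)) * ρ (inj₁ (f Fin.zero)))) (eval-foldr-tabulate M (f ∘ Fin.suc) ρ))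
          (solve 3 (λ a s t → a :+ s :+ t := a :+ (t :+ s)) refl (+ M)
            (∑[ i < k ] (+ (2 ℕ.^ toℕ (f (Fin.suc i))) * ρ (inj₁ (f (Fin.suc i))))) (+ (2 ℕ.^ toℕ (f Fin.zero)) * ρ (inj₁ (f Fin.zero))))
    where open ℤ-Solver.+-*-Solver

  eval-mainPoly : ∀ n M (ρ : Var n → ℤ) → eval ρ (mainPoly n M) ≡ + M + ∑[ i < n ] (+ (2 ℕ.^ toℕ i) * ρ (inj₁ i))
  eval-mainPoly n M = eval-foldr-tabulate M id

  bit : Bool → ℤ
  bit false = 0ℤ
  bit true  = 1ℤ

  parity : ∀ s → ∃[ r ] bit r ≡ + (s % 2)
  parity s with s % 2 | m%n<n s 2
  ... | 0           | _               = false , refl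
  ... | 1           | _               = true , refl
  ... | suc (suc _) | s≤s (s≤s ())

  binary-expansion : ∀ k s → s ℕ.< 2 ℕ.^ k → Σ[ b ∈ (Fin k → Bool) ] ∑[ i < k ] (+ (2 ℕ.^ toℕ i) * bit (b i)) ≡ + s
  binary-expansion zero    zero    _        = (λ ()) , refl
  binary-expansion zero    (suc s) (s≤s ())
  binary-expansion (suc k) s s<2^[1+k]
    with r , r≡s%2 ← parity s
       | b , ∑≡s/2 ← binary-expansion k (s / 2) (m<n*o⇒m/o<n (subst (s ℕ.<_) (ℕ.*-comm 2 (2 ℕ.^ k)) s<2^[1+k]))
    = digits , expansion
    where
      digits : Fin (suc k) → Bool
      digits Fin.zero    = r
      digits (Fin.suc i) = b i
      shift : ∀ i → + (2 ℕ.^ suc (toℕ i)) * bit (b i) ≡ + 2 * (+ (2 ℕ.^ toℕ i) * bit (b i))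
      shift i = trans (cong (_* bit (b i)) (pos-* 2 (2 ℕ.^ toℕ i))) (*-assoc (+ 2) (+ (2 ℕ.^ toℕ i)) (bit (b i)))
      higher-digits : ∑[ i < k ] (+ (2 ℕ.^ suc (toℕ i)) * bit (b i)) ≡ + 2 * ∑[ i < k ] (+ (2 ℕ.^ toℕ i) * bit (b i))
      higher-digits = trans (sum-cong-≗ shift) (sym (*-distribˡ-sum (+ 2) (λ i → + (2 ℕ.^ toℕ i) * bit (b i))))
      expansion : ∑[ i < suc k ] (+ (2 ℕ.^ toℕ i) * bit (digits i)) ≡ + s
      expansion = begin
        + 1 * bit r + ∑[ i < k ] (+ (2 ℕ.^ suc (toℕ i)) * bit (b i))
          ≡⟨ cong₂ _+_ (trans (*-identityˡ (bit r)) r≡s%2) higher-digits ⟩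
        + (s % 2) + + 2 * ∑[ i < k ] (+ (2 ℕ.^ toℕ i) * bit (b i))
          ≡⟨ cong (λ t → + (s % 2) + + 2 * t) ∑≡s/2 ⟩
        + (s % 2) + + 2 * + (s / 2)
          ≡⟨ trans (cong (_+_ (+ (s % 2))) (sym (pos-* 2 (s / 2)))) (sym (pos-+ (s % 2) (2 ℕ.* (s / 2)))) ⟩
        + (s % 2 ℕ.+ 2 ℕ.* (s / 2))
          ≡⟨ cong (λ t → + (s % 2 ℕ.+ t)) (ℕ.*-comm 2 (s / 2)) ⟩
        + (s % 2 ℕ.+ s / 2 ℕ.* 2)
          ≡⟨ cong +_ (sym (m≡m%n+[m/n]*n s 2)) ⟩
        + s ∎
        where open ≡-Reasoning

  -- s := M (p - 1) mod p works, since M + M (p - 1) = M p.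
  complement-mod : ∀ M p .{{_ : NonZero p}} → ∃[ s ] s ℕ.< p × p ℕ.∣ M ℕ.+ s
  complement-mod M p@(suc p-1) = u % p , m%n<n u p , ℕ.∣m+n∣m⇒∣n (subst (p ℕ.∣_) Mp≡ (ℕ.n∣m*n M)) (ℕ.n∣m*n (u / p))
    where
      u : ℕ
      u = M ℕ.* p-1
      Mp≡ : M ℕ.* p ≡ u / p ℕ.* p ℕ.+ (M ℕ.+ u % p)
      Mp≡ = begin
        M ℕ.* p                              ≡⟨ ℕ.*-suc M p-1 ⟩
        M ℕ.+ u                              ≡⟨ cong (M ℕ.+_) (trans (m≡m%n+[m/n]*n u p) (ℕ.+-comm (u % p) _)) ⟩
        M ℕ.+ (u / p ℕ.* p ℕ.+ u % p)        ≡⟨ solve 3 (λ M a b → M :+ (a :+ b) := a :+ (M :+ b)) refl M (u / p ℕ.* p) (u % p) ⟩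
        u / p ℕ.* p ℕ.+ (M ℕ.+ u % p)        ∎
        where
          open ≡-Reasoning
          open ℕ-Solver.+-*-Solver

  prime-divides-clause-constant : ∀ {n M} (R : Refutation n M) {p} → Prime p → p ℕ.≤ 2 ℕ.^ n →
    Any (λ e → p ℕ.∣ ℤ.∣ proj₁ e ∣) (Refutation.cnf R)
  prime-divides-clause-constant {n} {M} R {p} p-prime p≤2^n
    with s , s<p , p∣M+s ← complement-mod M p {{prime⇒nonZero p-prime}}
    with b , ∑≡s ← binary-expansion n s (ℕ.<-≤-trans s<p p≤2^n)
    with any? (λ e → p ℕ.∣? ℤ.∣ proj₁ e ∣) (Refutation.cnf R)
  ... | yes p∣C = p∣C
  ... | no  p∤C = ⊥-elim (unsat (truthModP ρ p-prime) (All.zipWith clause-satisfied (clauseDerived , ¬Any⇒All¬ cnf p∤C)))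
    where
      open Refutation R
      open Extension q (bit ∘ b) using (extend; extension-axioms-vanish)
      ρ : Var n → ℤ
      ρ = extend
      axioms-vanish : ∀ {a} → Axiom n M m q a → + p ∣ eval ρ a
      axioms-vanish (bool i) with b i
      ... | false = divides 0ℤ refl
      ... | true  = divides 0ℤ refl
      axioms-vanish main = subst (+ p ∣_) (sym main≡M+s) (∣ᵤ⇒∣ p∣M+s)
        where
          main≡M+s : eval ρ (mainPoly n M) ≡ + (M ℕ.+ s)
          main≡M+s = trans (eval-mainPoly n M ρ) (trans (cong (_+_ (+ M)) ∑≡s) (sym (pos-+ M s)))
      axioms-vanish (ext j) = subst (+ p ∣_) (sym (extension-axioms-vanish q-wf j)) (divides 0ℤ refl)
      clause-satisfied : ∀ {e} →
        (proj₁ e ≢ 0ℤ × Derives (Axiom n M m q) (con (proj₁ e) ⊗ clausePoly (proj₂ e))) × ¬ p ℕ.∣ ℤ.∣ proj₁ e ∣ →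
        Satisfies (truthModP ρ p-prime) (proj₂ e)
      clause-satisfied {C , cl} ((_ , derivation) , p∤C)
        with euclidsLemmaℤ p-prime C (eval ρ (clausePoly cl)) (derivable-vanish ρ p-prime axioms-vanish derivation)
      ... | inj₁ p∣C   = contradiction (∣⇒∣ᵤ p∣C) p∤C
      ... | inj₂ p∣cl  = clause-vanishes⇒satisfied ρ p-prime cl p∣cl

module Counting where

  open import Data.Nat using (ℕ; zero; suc; _≤_; _<_; _^_; _*_; _+_; _≤?_; _∸_; NonZero)
  open import Data.Nat.Properties
  open import Data.Nat.Divisibility using (_∣_; _∣?_)
  open import Data.Nat.Primality using (prime?)
  open import Data.Integer as ℤ using (ℤ)
  open import Data.List using (List; length; filter; upTo)
  import Data.List.Relation.Unary.All as All
  import Data.List.Relation.Unary.All.Properties as Allₚ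
  open import Data.List.Relation.Unary.Any as Any using (Any)
  import Data.List.Relation.Unary.Unique.Propositional.Properties as Uniqueₚ
  open import Data.Product using (_,_; proj₁)
  open import Data.Sum using (_⊎_; inj₁; inj₂)
  open import Relation.Nullary using (Dec; yes; no; contradiction)
  open import Relation.Nullary.Decidable using (toWitness)
  open import Relation.Binary.PropositionalEquality
  open import Data.Nat.Solver using (module +-*-Solver)
  open +-*-Solver

  open PrimeCounting using (primesUpTo; primesUpTo-bounded; primeCount-lower)
  open Pigeonhole using (pigeonhole)
  open ModularSemantics using (prime-divides-clause-constant)

  [12+t]^3≤2^[11+t] : ∀ t → (12 + t) ^ 3 ≤ 2 ^ (11 + t)
  [12+t]^3≤2^[11+t] zero = toWitness {a? = 12 ^ 3 ≤? 2 ^ 11} _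
  [12+t]^3≤2^[11+t] (suc t) = begin
    (13 + t) ^ 3                                               ≤⟨ m≤m+n ((13 + t) ^ 3) slack ⟩
    (13 + t) ^ 3 + slack                                       ≡⟨ slack-fills ⟩
    2 * (12 + t) ^ 3                                           ≤⟨ *-monoʳ-≤ 2 ([12+t]^3≤2^[11+t] t) ⟩
    2 * 2 ^ (11 + t)                                           ∎
    where
      open ≤-Reasoning
      slack : ℕ
      slack = 1259 + 357 * t + 33 * (t * t) + t * t * t
      slack-fills : (13 + t) ^ 3 + slack ≡ 2 * (12 + t) ^ 3
      slack-fills = solve 1 (λ t → (con 13 :+ t) :^ 3 :+ (con 1259 :+ con 357 :* t :+ con 33 :* (t :* t) :+ t :* t :* t)
                                 := con 2 :* ((con 12 :+ t) :^ 3)) refl t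

  [1+n]^3≤2^n : ∀ {n} → 11 ≤ n → suc n ^ 3 ≤ 2 ^ n
  [1+n]^3≤2^n {n} 11≤n = subst (λ m → suc m ^ 3 ≤ 2 ^ m) (m+[n∸m]≡n 11≤n) ([12+t]^3≤2^[11+t] (n ∸ 11))

  2^[1+n]≤[2k]^3 : ∀ {n π L k} → 11 ≤ n → 2 ^ n ≤ suc n * π → π ≤ L * k → L ^ 3 ≤ 2 ^ suc n → 2 ^ suc n ≤ (2 * k) ^ 3
  2^[1+n]≤[2k]^3 {n} {π} {L} {k} 11≤n N≤[1+n]π π≤Lk L^3≤2N = begin
    2 * N                            ≤⟨ *-monoʳ-≤ 2 N≤2k^3 ⟩
    2 * (2 * k ^ 3)                  ≤⟨ m≤m+n (2 * (2 * k ^ 3)) (4 * k ^ 3) ⟩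
    2 * (2 * k ^ 3) + 4 * k ^ 3      ≡⟨ solve 1 (λ k → con 2 :* (con 2 :* k :^ 3) :+ con 4 :* k :^ 3 := (con 2 :* k) :^ 3) refl k ⟩
    (2 * k) ^ 3                      ∎
    where
      open ≤-Reasoning
      N : ℕ
      N = 2 ^ n
      instance
        N*N≢0 : NonZero (N * N)
        N*N≢0 = m*n≢0 N N {{m^n≢0 2 n}} {{m^n≢0 2 n}}
      N³≤2k³N² : N * (N * N) ≤ 2 * k ^ 3 * (N * N)
      N³≤2k³N² = begin
        N * (N * N)                   ≡⟨ solve 1 (λ N → N :* (N :* N) := N :^ 3) refl N ⟩
        N ^ 3                         ≤⟨ ^-monoˡ-≤ 3 (≤-trans N≤[1+n]π (*-monoʳ-≤ (suc n) π≤Lk)) ⟩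
        (suc n * (L * k)) ^ 3         ≡⟨ solve 3 (λ c L k → (c :* (L :* k)) :^ 3 := c :^ 3 :* L :^ 3 :* k :^ 3) refl (suc n) L k ⟩
        suc n ^ 3 * L ^ 3 * k ^ 3     ≤⟨ *-monoˡ-≤ (k ^ 3) (*-mono-≤ ([1+n]^3≤2^n 11≤n) L^3≤2N) ⟩
        N * (2 * N) * k ^ 3           ≡⟨ solve 2 (λ N k → N :* (con 2 :* N) :* k :^ 3 := con 2 :* k :^ 3 :* (N :* N)) refl N k ⟩
        2 * k ^ 3 * (N * N)           ∎
      N≤2k^3 : N ≤ 2 * k ^ 3
      N≤2k^3 = *-cancelʳ-≤ N (2 * k ^ 3) (N * N) N³≤2k³N²

  primesDividing : ℤ → ℕ → List ℕ
  primesDividing C N = filter (λ p → p ∣? ℤ.∣ C ∣) (primesUpTo N)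

  manyPrimes-primesDividing : ∀ d n N C → 2 ^ n ≤ (d * length (primesDividing C N)) ^ 3 → ManyPrimes d n C
  manyPrimes-primesDividing d n N C bound =
    primesDividing C N ,
    Uniqueₚ.filter⁺ C? (Uniqueₚ.filter⁺ prime? (Uniqueₚ.upTo⁺ (suc N))) ,
    Allₚ.filter⁺ C? (Allₚ.all-filter prime? (upTo (suc N))) ,
    Allₚ.all-filter C? (primesUpTo N) ,
    bound
    where
      C? : ∀ p → Dec (p ∣ ℤ.∣ C ∣)
      C? p = p ∣? ℤ.∣ C ∣

  many-clauses⊎many-primes : ∀ n {M} (R : Refutation (suc n) M) → 11 ≤ n →
    2 ^ suc n ≤ length (Refutation.cnf R) ^ 3 ⊎ Any (λ e → ManyPrimes 2 (suc n) (proj₁ e)) (Refutation.cnf R)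
  many-clauses⊎many-primes n R 11≤n
    with pigeonhole (λ p e → p ∣? ℤ.∣ proj₁ e ∣) (Refutation.cnf R) (primesUpTo (2 ^ suc n))
           (All.map (λ (p-prime , p≤2^n) → prime-divides-clause-constant R p-prime p≤2^n) (primesUpTo-bounded (2 ^ suc n)))
  ... | inj₁ no-primes = contradiction (subst (λ ps → 2 ^ n ≤ suc n * length ps) no-primes (primeCount-lower n))
                                       (<⇒≱ (subst (_< 2 ^ n) (sym (*-zeroʳ (suc n))) (m^n>0 2 n)))
  ... | inj₂ popular with 2 ^ suc n ≤? length (Refutation.cnf R) ^ 3
  ...   | yes many-clauses = inj₁ many-clauses
  ...   | no few-clauses   = inj₂ (Any.map (λ {e} π≤Lk → manyPrimes-primesDividing 2 (suc n) (2 ^ suc n) (proj₁ e)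
      (2^[1+n]≤[2k]^3 {L = length (Refutation.cnf R)} {k = length (primesDividing (proj₁ e) (2 ^ suc n))}
        11≤n (primeCount-lower n) π≤Lk (<⇒≤ (≰⇒> few-clauses)))) popular)

open Counting using (many-clauses⊎many-primes)

theorem4 : Σ ℕ λ d → (1 ≤ d) × Σ ℕ λ n₀ →
    (n : ℕ) → n₀ ≤ n → (M : ℕ) → 1 ≤ M → (R : Refutation n M) →
    (2 ^ n ≤ length (Refutation.cnf R) ^ 3)
    ⊎ (Σ (Var n) λ v → Σ (Occurs v (Refutation.cnf R)) λ occ →
    ManyPrimes d n (Refutation.boolConst R v))
    ⊎ Any (λ e → ManyPrimes d n (proj₁ e)) (Refutation.cnf R)
theorem4 = 2 , s≤s z≤n , 12 , λ where
  (suc n) (s≤s 11≤n) M _ R → map₂ inj₂ (many-clauses⊎many-primes n R 11≤n)
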